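{- Let $n\ge 2$ be even and $1\le\Delta\le\lfloor\log_2 n\rfloor$ with $\Delta<\log_2(n/2+2)$, and consider the Kn\"odel graph $W_{\Delta,n}$ with partite sets $U=\{u_1,\dots,u_{n/2}\}$ and $V=\{v_1,\dots,v_{n/2}\}$. Then: (i) $|N(u_i)\cap N(u_j)|\le 1$ for all $1\le i<j\le n/2$; (ii) for $1\le i<j\le n/2$, $|N(u_i)\cap N(u_j)|=1$ if and only if $id(u_i,u_j)\in\mathscr{M}_\Delta$.
   Context: The Kn\"odel graph $W_{\Delta,n}$ (for even $n\ge2$, $1\le\Delta\le\lfloor\log_2 n\rfloor$) is the bipartite graph with partite sets $U=\{u_1,\dots,u_{n/2}\}$ and $V=\{v_1,\dots,v_{n/2}\}$ in which $u_i$ and $v_j$ are adjacent if and only if $j\equiv i+2^k-1 \pmod{n/2}$ for some $k\in\{0,1,\dots,\Delta-1\}$ (indices taken in $\{1,\dots,n/2\}$). $N(x)$ denotes the open neighborhood of a vertex $x$. For $u_i,u_j\in U$ the index-distance is $id(u_i,u_j)=\min\{|i-j|,\ \frac{n}{2}-|i-j|\}$. The set $\mathscr{M}_\Delta$ is $\{2^a-2^b: 0\le b<a<\Delta\}$ (integers $a,b$). -}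

module Defs where

open import Data.Nat using (ℕ; zero; suc; _+_; _*_; _∸_; _^_; _≤_; _<_; NonZero; _≟_)
open import Data.Nat.DivMod using (_%_)
open import Data.Nat.Base using (_⊓_)
open import Data.Fin using (Fin; toℕ)
open import Data.Fin.Properties using (any?)
open import Data.List using (List; length; filter; allFin)
open import Data.Product using (Σ; ∃; _×_; _,_)
open import Relation.Nullary using (Dec)
open import Relation.Nullary.Decidable using (_×-dec_)
open import Relation.Binary.PropositionalEquality using (_≡_)

-- Knödel graph W_{Δ,n} with n = 2m.  Both partite sets U = {u_1..u_m} and
-- V = {v_1..v_m} are indexed by Fin m; the element i : Fin m stands for the
-- paper's index  toℕ i + 1  ∈ {1,…,m}.

idx : ∀ {m} → Fin m → ℕ
idx i = suc (toℕ i)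

Adj : (m Δ : ℕ) .{{_ : NonZero m}} → Fin m → Fin m → Set
Adj m Δ i j = Σ (Fin Δ) λ k → (idx i + 2 ^ toℕ k ∸ 1) % m ≡ idx j % m

Adj? : (m Δ : ℕ) .{{_ : NonZero m}} → (i j : Fin m) → Dec (Adj m Δ i j)
Adj? m Δ i j = any? λ k → (idx i + 2 ^ toℕ k ∸ 1) % m ≟ idx j % m

commonNbrs : (m Δ : ℕ) .{{_ : NonZero m}} → Fin m → Fin m → List (Fin m)
commonNbrs m Δ i j = filter (λ l → Adj? m Δ i l ×-dec Adj? m Δ j l) (allFin m)

numCommon : (m Δ : ℕ) .{{_ : NonZero m}} → Fin m → Fin m → ℕ
numCommon m Δ i j = length (commonNbrs m Δ i j)

absDiff : ℕ → ℕ → ℕ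
absDiff x y = (x ∸ y) + (y ∸ x)

indexDist : (m : ℕ) → Fin m → Fin m → ℕ
indexDist m i j = absDiff (idx i) (idx j) ⊓ (m ∸ absDiff (idx i) (idx j))

InM : ℕ → ℕ → Set
InM Δ x = ∃ λ a → ∃ λ b → (b < a) × (a < Δ) × (x ≡ 2 ^ a ∸ 2 ^ b)

module Submission where

-- Write I < J for the 0-based indices of u_i, u_j and d = J - I.  A vertex v_l
-- is a common neighbour iff  I + 2^a ≡ l ≡ J + 2^b (mod m)  for exponents
-- a, b < Δ, i.e. iff d ≡ 2^a - 2^b (mod m).  Under the hypothesis 2^Δ ≤ m + 1
-- every power involved is at most m, so this congruence has exactly two
-- readings without residues: d is the gap  2^a = d + 2^b,  or, wrapping
-- around once, m - d is the gap  2^b = (m - d) + 2^a.  A gap x between powers below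
-- 2^Δ is shorter than half the cycle (x < m - x), so at most one reading can
-- occur and the gap realised is exactly  min(d, m - d) = id(u_i, u_j).
-- Since gaps 2^a - 2^b (a > b) determine a and b (uniqueness of binary
-- representations), the exponent a, and hence l, is unique: at most one
-- common neighbour.  Conversely any gap in 𝓜_Δ equal to min(d, m - d) yields
-- a residue l adjacent to both.

open import Data.Nat
open import Data.Nat.Properties
open import Data.Nat.DivMod
open import Data.Nat.Tactic.RingSolver using (solve-∀)
open import Data.Fin using (Fin; toℕ; fromℕ<)
open import Data.Fin.Properties using (toℕ<n; toℕ-injective; toℕ-fromℕ<)
open import Data.List using (List; []; _∷_; length; filter; allFin)
open import Data.List.Properties using (filter-some)
open import Data.List.Relation.Unary.All using (All; _∷_)
open import Data.List.Relation.Unary.All.Properties using (all-filter)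
open import Data.List.Relation.Unary.AllPairs using (_∷_)
open import Data.List.Relation.Unary.Unique.Propositional using (Unique)
open import Data.List.Relation.Unary.Unique.Propositional.Properties
  using (allFin⁺) renaming (filter⁺ to unique-filter⁺)
open import Data.List.Membership.Propositional using (lose)
open import Data.List.Membership.Propositional.Properties using (∈-allFin)
open import Data.Product using (Σ; ∃₂; _×_; _,_; proj₁; swap)
open import Data.Sum using (_⊎_; inj₁; inj₂)
open import Function.Bundles using (_⇔_; mk⇔)
open import Level using (0ℓ)
open import Relation.Binary using (tri<; tri≈; tri>)
open import Relation.Binary.PropositionalEquality
open import Relation.Nullary using (¬_; yes; no; contradiction)
open import Relation.Nullary.Decidable using (_×-dec_)
open import Relation.Unary using (Pred; Decidable)
open import Data.Nat.Logarithm using (⌊log₂_⌋)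
open import Defs

pow2-cancel-< : ∀ {a b} → 2 ^ a < 2 ^ b → a < b
pow2-cancel-< {a} {b} lt with a <? b
... | yes a<b = a<b
... | no a≮b = contradiction lt (≤⇒≯ (^-monoʳ-≤ 2 (≮⇒≥ a≮b)))

pow2-injective : ∀ {a b} → 2 ^ a ≡ 2 ^ b → a ≡ b
pow2-injective {a} {b} eq with <-cmp a b
... | tri< a<b _ _ = contradiction eq (<⇒≢ (^-monoʳ-< 2 (s≤s (s≤s z≤n)) a<b))
... | tri≈ _ a≡b _ = a≡b
... | tri> _ _ b<a = contradiction (sym eq) (<⇒≢ (^-monoʳ-< 2 (s≤s (s≤s z≤n)) b<a))

even+even≢odd : ∀ x y z → 2 * x + 2 * y ≢ 2 * z + 1
even+even≢odd x y z eq =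
  even≢odd (x + y) z (trans (*-distribˡ-+ 2 x y) (trans eq (+-comm (2 * z) 1)))

-- Uniqueness of binary representation for two-term sums: if
-- 2^a + 2^e = 2^c + 2^b with b < a and e < c, then a = c and b = e.
-- (Compare parities, then halve.)
pow2-sum-unique : ∀ {a b c e} → b < a → e < c →
  2 ^ a + 2 ^ e ≡ 2 ^ c + 2 ^ b → a ≡ c × b ≡ e
pow2-sum-unique {a} {zero} {c} {zero} _ _ eq = pow2-injective (+-cancelʳ-≡ 1 _ _ eq) , refl
pow2-sum-unique {suc a} {zero} {suc c} {suc e} _ _ eq =
  contradiction eq (even+even≢odd (2 ^ a) (2 ^ e) (2 ^ c))
pow2-sum-unique {suc a} {suc b} {suc c} {zero} _ _ eq =
  contradiction (sym eq) (even+even≢odd (2 ^ c) (2 ^ b) (2 ^ a))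
pow2-sum-unique {suc a} {suc b} {suc c} {suc e} (s≤s b<a) (s≤s e<c) eq
  with pow2-sum-unique b<a e<c (*-cancelˡ-≡ _ _ 2 halved)
  where
  halved : 2 * (2 ^ a + 2 ^ e) ≡ 2 * (2 ^ c + 2 ^ b)
  halved = trans (*-distribˡ-+ 2 (2 ^ a) (2 ^ e))
                 (trans eq (sym (*-distribˡ-+ 2 (2 ^ c) (2 ^ b))))
... | a≡c , b≡e = cong suc a≡c , cong suc b≡e

Gap : ℕ → ℕ → ℕ → Set
Gap x a b = 2 ^ a ≡ x + 2 ^ b

gap-exponents : ∀ {x a b} → 0 < x → Gap x a b → b < a
gap-exponents {x} {a} {b} x>0 g = pow2-cancel-< (subst (2 ^ b <_) (sym g) (m<n+m (2 ^ b) x>0))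

gap-unique : ∀ {x a b a′ b′} → 0 < x → Gap x a b → Gap x a′ b′ → a ≡ a′ × b ≡ b′
gap-unique {x} {a} {b} {a′} {b′} x>0 g g′ =
  pow2-sum-unique (gap-exponents x>0 g) (gap-exponents x>0 g′) cross
  where
  open ≡-Reasoning
  cross : 2 ^ a + 2 ^ b′ ≡ 2 ^ a′ + 2 ^ b
  cross = begin
    2 ^ a + 2 ^ b′        ≡⟨ cong (_+ 2 ^ b′) g ⟩
    x + 2 ^ b + 2 ^ b′    ≡⟨ +-assoc x (2 ^ b) (2 ^ b′) ⟩
    x + (2 ^ b + 2 ^ b′)  ≡⟨ cong (x +_) (+-comm (2 ^ b) (2 ^ b′)) ⟩
    x + (2 ^ b′ + 2 ^ b)  ≡⟨ sym (+-assoc x (2 ^ b′) (2 ^ b)) ⟩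
    x + 2 ^ b′ + 2 ^ b    ≡⟨ cong (_+ 2 ^ b) (sym g′) ⟩
    2 ^ a′ + 2 ^ b        ∎

gap⇒InM : ∀ {Δ x a b} → 0 < x → a < Δ → Gap x a b → InM Δ x
gap⇒InM {Δ} {x} {a} {b} x>0 a<Δ g =
  a , b , gap-exponents x>0 g , a<Δ , sym (trans (cong (_∸ 2 ^ b) g) (m+n∸n≡m x (2 ^ b)))

InM⇒gap : ∀ {Δ x} → InM Δ x → ∃₂ λ a b → a < Δ × b < Δ × Gap x a b
InM⇒gap {Δ} {x} (a , b , b<a , a<Δ , x≡) =
  a , b , a<Δ , <-trans b<a a<Δ ,
  sym (trans (cong (_+ 2 ^ b) x≡) (m∸n+n≡m (^-monoʳ-≤ 2 (<⇒≤ b<a))))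

module Residues (m : ℕ) .{{_ : NonZero m}} where

  below-two-periods : ∀ A → A < m + m → A ≡ A % m ⊎ A ≡ A % m + m
  below-two-periods A A<2m with A <? m
  ... | yes A<m = inj₁ (sym (m<n⇒m%n≡m A<m))
  ... | no A≮m = inj₂ (begin
    A            ≡⟨ sym (m∸n+n≡m m≤A) ⟩
    A ∸ m + m    ≡⟨ cong (_+ m) (sym residue) ⟩
    A % m + m    ∎)
    where
    open ≡-Reasoning
    m≤A : m ≤ A
    m≤A = ≮⇒≥ A≮m
    residue : A % m ≡ A ∸ m
    residue = trans (sym (m≤n⇒[n∸m]%m≡n%m m≤A)) (m<n⇒m%n≡m (m<n+o⇒m∸n<o A m A<2m))

  same-residue-cases : ∀ {A B} → A < m + m → B < m + m → A % m ≡ B % m →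
    A ≡ B ⊎ A + m ≡ B ⊎ A ≡ B + m
  same-residue-cases {A} {B} A<2m B<2m e
    with below-two-periods A A<2m | below-two-periods B B<2m
  ... | inj₁ A≡ | inj₁ B≡ = inj₁ (trans A≡ (trans e (sym B≡)))
  ... | inj₁ A≡ | inj₂ B≡ = inj₂ (inj₁ (trans (cong (_+ m) (trans A≡ e)) (sym B≡)))
  ... | inj₂ A≡ | inj₁ B≡ = inj₂ (inj₂ (trans A≡ (cong (_+ m) (trans e (sym B≡)))))
  ... | inj₂ A≡ | inj₂ B≡ = inj₁ (trans A≡ (trans (cong (_+ m) e) (sym B≡)))

  idx<2m : (k : Fin m) → idx k < m + m
  idx<2m k = ≤-<-trans (toℕ<n k) (m<m+n m (>-nonZero⁻¹ m))

  idx-no-wrap : (k k′ : Fin m) → idx k′ ≢ idx k + m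
  idx-no-wrap k k′ = <⇒≢ (≤-<-trans (toℕ<n k′) (m<n+m m z<s))

  idx-residue-injective : (l l′ : Fin m) → idx l % m ≡ idx l′ % m → l ≡ l′
  idx-residue-injective l l′ e with same-residue-cases (idx<2m l) (idx<2m l′) e
  ... | inj₁ same = toℕ-injective (suc-injective same)
  ... | inj₂ (inj₁ wrap) = contradiction (sym wrap) (idx-no-wrap l l′)
  ... | inj₂ (inj₂ wrap) = contradiction wrap (idx-no-wrap l′ l)

  residue-index : ∀ T → 0 < T → Σ (Fin m) λ l → T % m ≡ idx l % m
  residue-index (suc T) _ = fromℕ< (m%n<n T m) , sym (begin
    suc (toℕ (fromℕ< (m%n<n T m))) % m  ≡⟨ cong (λ r → suc r % m) (toℕ-fromℕ< (m%n<n T m)) ⟩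
    (1 + T % m) % m                      ≡⟨ %-distribˡ-+ 1 (T % m) m ⟩
    (1 % m + T % m % m) % m              ≡⟨ cong (λ r → (1 % m + r) % m) (m%n%n≡m%n T m) ⟩
    (1 % m + T % m) % m                  ≡⟨ sym (%-distribˡ-+ 1 T m) ⟩
    suc T % m                            ∎)
    where open ≡-Reasoning

module ShortPowers (m Δ : ℕ) .{{_ : NonZero m}} (short : 2 ^ Δ ≤ m + 1) where

  open Residues m

  double-pow≤ : ∀ {a} → a < Δ → 2 ^ a + 2 ^ a ≤ m + 1
  double-pow≤ {a} a<Δ = begin
    2 ^ a + 2 ^ a        ≡⟨ cong (2 ^ a +_) (sym (+-identityʳ (2 ^ a))) ⟩
    2 ^ suc a            ≤⟨ ^-monoʳ-≤ 2 a<Δ ⟩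
    2 ^ Δ                ≤⟨ short ⟩
    m + 1                ∎
    where open ≤-Reasoning

  pow≤m : ∀ {a} → a < Δ → 2 ^ a ≤ m
  pow≤m {a} a<Δ =
    +-cancelʳ-≤ 1 (2 ^ a) m (≤-trans (+-monoʳ-≤ (2 ^ a) (m^n>0 2 a)) (double-pow≤ a<Δ))

  gap-short : ∀ {x a b} → a < Δ → Gap x a b → x < m ∸ x
  gap-short {x} {a} {b} a<Δ g = m+n≤o⇒m≤o∸n (suc x) (s≤s⁻¹ twice)
    where
    open ≤-Reasoning
    x<2^a : suc x ≤ 2 ^ a
    x<2^a = subst (suc x ≤_) (sym g) (m<m+n x (m^n>0 2 b))
    twice : suc (suc x + x) ≤ suc m
    twice = begin
      suc (suc x + x)      ≡⟨ cong suc (sym (+-suc x x)) ⟩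
      suc x + suc x        ≤⟨ +-mono-≤ x<2^a x<2^a ⟩
      2 ^ a + 2 ^ a        ≤⟨ double-pow≤ a<Δ ⟩
      m + 1                ≡⟨ +-comm m 1 ⟩
      suc m                ∎

  -- d ≡ 2^a - 2^b (mod m), read without residues: either d itself is the
  -- gap, or the gap is m - d in the opposite direction.
  Realises : ℕ → ℕ → ℕ → Set
  Realises d a b = Gap d a b ⊎ Gap (m ∸ d) b a

  no-two-short-gaps : ∀ {d} → d < m → d < m ∸ d → ¬ (m ∸ d < m ∸ (m ∸ d))
  no-two-short-gaps {d} d<m short-d short-m∸d =
    <-asym short-d (subst (m ∸ d <_) (m∸[m∸n]≡n (<⇒≤ d<m)) short-m∸d)

  realises-unique : ∀ {d a b a′ b′} → 0 < d → d < m →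
    a < Δ → b < Δ → a′ < Δ → b′ < Δ →
    Realises d a b → Realises d a′ b′ → a ≡ a′ × b ≡ b′
  realises-unique d>0 d<m _ _ _ _ (inj₁ g) (inj₁ g′) = gap-unique d>0 g g′
  realises-unique d>0 d<m _ _ _ _ (inj₂ g) (inj₂ g′) = swap (gap-unique (m<n⇒0<n∸m d<m) g g′)
  realises-unique {b = b} {a′ = a′} _ d<m a<Δ _ _ b′<Δ (inj₁ g) (inj₂ g′) =
    contradiction (gap-short {b = a′} b′<Δ g′) (no-two-short-gaps d<m (gap-short {b = b} a<Δ g))
  realises-unique {a = a} {b′ = b′} _ d<m _ b<Δ a′<Δ _ (inj₂ g) (inj₁ g′) =
    contradiction (gap-short {b = a} b<Δ g) (no-two-short-gaps d<m (gap-short {b = b′} a′<Δ g′))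

  realises⇒InM : ∀ {d a b} → 0 < d → d < m → a < Δ → b < Δ →
    Realises d a b → InM Δ (d ⊓ (m ∸ d))
  realises⇒InM {b = b} d>0 _ a<Δ _ (inj₁ g) =
    subst (InM Δ) (sym (m≤n⇒m⊓n≡m (<⇒≤ (gap-short {b = b} a<Δ g))))
          (gap⇒InM {b = b} d>0 a<Δ g)
  realises⇒InM {d} {a} d>0 d<m _ b<Δ (inj₂ g) =
    subst (InM Δ) (sym (m≥n⇒m⊓n≡n m∸d≤d)) (gap⇒InM {b = a} (m<n⇒0<n∸m d<m) b<Δ g)
    where
    m∸d≤d : m ∸ d ≤ d
    m∸d≤d = subst (m ∸ d ≤_) (m∸[m∸n]≡n (<⇒≤ d<m)) (<⇒≤ (gap-short {b = a} b<Δ g))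

  InM⇒realises : ∀ {d} → InM Δ (d ⊓ (m ∸ d)) → ∃₂ λ a b → a < Δ × b < Δ × Realises d a b
  InM⇒realises {d} x∈M with InM⇒gap x∈M | ≤-total d (m ∸ d)
  ... | a , b , a<Δ , b<Δ , g | inj₁ d≤m∸d =
    a , b , a<Δ , b<Δ , inj₁ (subst (λ x → Gap x a b) (m≤n⇒m⊓n≡m d≤m∸d) g)
  ... | a , b , a<Δ , b<Δ , g | inj₂ m∸d≤d =
    b , a , b<Δ , a<Δ , inj₂ (subst (λ x → Gap x a b) (m≥n⇒m⊓n≡n m∸d≤d) g)

  residues⇒realises : ∀ I d {a b} → I + d < m → a < Δ → b < Δ →
    (I + 2 ^ a) % m ≡ (I + d + 2 ^ b) % m → Realises d a b
  residues⇒realises I d {a} {b} I+d<m a<Δ b<Δ e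
    with same-residue-cases (+-mono-<-≤ (≤-<-trans (m≤m+n I d) I+d<m) (pow≤m a<Δ))
                            (+-mono-<-≤ I+d<m (pow≤m b<Δ)) e
  ... | inj₁ same = inj₁ (+-cancelˡ-≡ I _ _ (trans same (+-assoc I d (2 ^ b))))
  ... | inj₂ (inj₁ wrap) = inj₂ (+-cancelˡ-≡ d _ _ (begin
    d + 2 ^ b              ≡⟨ +-cancelˡ-≡ I _ _ (trans (sym (+-assoc I d (2 ^ b))) (trans (sym wrap) (+-assoc I (2 ^ a) m))) ⟩
    2 ^ a + m              ≡⟨ cong (2 ^ a +_) (sym (m+[n∸m]≡n d≤m)) ⟩
    2 ^ a + (d + (m ∸ d))  ≡⟨ rearrange (2 ^ a) d (m ∸ d) ⟩
    d + (m ∸ d + 2 ^ a)    ∎))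
    where
    open ≡-Reasoning
    d≤m : d ≤ m
    d≤m = <⇒≤ (≤-<-trans (m≤n+m d I) I+d<m)
    rearrange : ∀ x y z → x + (y + z) ≡ y + (z + x)
    rearrange = solve-∀
  ... | inj₂ (inj₂ over) = contradiction over (<⇒≢ (begin-strict
    I + 2 ^ a              ≤⟨ +-monoʳ-≤ I (pow≤m a<Δ) ⟩
    I + m                  <⟨ +-monoʳ-< I (m<n+m m (m^n>0 2 b)) ⟩
    I + (2 ^ b + m)        ≤⟨ +-monoʳ-≤ I (m≤n+m (2 ^ b + m) d) ⟩
    I + (d + (2 ^ b + m))  ≡⟨ rearrange I d (2 ^ b) m ⟩
    I + d + 2 ^ b + m      ∎))
    where
    open ≤-Reasoning
    rearrange : ∀ w x y z → w + (x + (y + z)) ≡ w + x + y + z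
    rearrange = solve-∀

  realises⇒residues : ∀ I d {a b} → d ≤ m → Realises d a b →
    (I + 2 ^ a) % m ≡ (I + d + 2 ^ b) % m
  realises⇒residues I d {a} {b} _ (inj₁ g) =
    cong (_% m) (trans (cong (I +_) g) (sym (+-assoc I d (2 ^ b))))
  realises⇒residues I d {a} {b} d≤m (inj₂ g) = sym (begin
    (I + d + 2 ^ b) % m              ≡⟨ cong (λ y → (I + d + y) % m) g ⟩
    (I + d + (m ∸ d + 2 ^ a)) % m    ≡⟨ cong (_% m) (rearrange I d (m ∸ d) (2 ^ a)) ⟩
    (I + 2 ^ a + (d + (m ∸ d))) % m  ≡⟨ cong (λ y → (I + 2 ^ a + y) % m) (m+[n∸m]≡n d≤m) ⟩
    (I + 2 ^ a + m) % m              ≡⟨ [m+n]%n≡m%n (I + 2 ^ a) m ⟩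
    (I + 2 ^ a) % m                  ∎)
    where
    open ≡-Reasoning
    rearrange : ∀ w x y z → w + x + (y + z) ≡ w + z + (x + y)
    rearrange = solve-∀

module _ {A : Set} {P : Pred A 0ℓ} where

  unique-length≤1 : ∀ {ys : List A} → Unique ys → All P ys →
    (∀ {x y} → P x → P y → x ≡ y) → length ys ≤ 1
  unique-length≤1 {[]} _ _ _ = z≤n
  unique-length≤1 {_ ∷ []} _ _ _ = ≤-refl
  unique-length≤1 {_ ∷ _ ∷ _} ((x≢y ∷ _) ∷ _) (px ∷ py ∷ _) at-most-one =
    contradiction (at-most-one px py) x≢y

  module _ (P? : Decidable P) where

    filter-length≤1 : ∀ xs → Unique xs → (∀ {x y} → P x → P y → x ≡ y) →
      length (filter P? xs) ≤ 1
    filter-length≤1 xs xs-unique =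
      unique-length≤1 (unique-filter⁺ P? xs-unique) (all-filter P? xs)

    filter-witness : ∀ xs → 0 < length (filter P? xs) → Σ A P
    filter-witness (x ∷ xs) nonempty with P? x
    ... | yes px = x , px
    ... | no _ = filter-witness xs nonempty

adjacent : ∀ {m Δ} .{{_ : NonZero m}} {x l : Fin m} {a} → a < Δ →
  (toℕ x + 2 ^ a) % m ≡ idx l % m → Adj m Δ x l
adjacent {m} {x = x} {l} a<Δ e =
  fromℕ< a<Δ , subst (λ k → (toℕ x + 2 ^ k) % m ≡ idx l % m) (sym (toℕ-fromℕ< a<Δ)) e

module Pair (m Δ : ℕ) .{{_ : NonZero m}} (short : 2 ^ Δ ≤ m + 1)
            (i j : Fin m) (i<j : toℕ i < toℕ j) where

  open Residues m
  open ShortPowers m Δ short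

  I d : ℕ
  I = toℕ i
  d = toℕ j ∸ toℕ i

  j≡I+d : toℕ j ≡ I + d
  j≡I+d = sym (m+[n∸m]≡n (<⇒≤ i<j))

  I+d<m : I + d < m
  I+d<m = subst (_< m) j≡I+d (toℕ<n j)

  d>0 : 0 < d
  d>0 = m<n⇒0<n∸m i<j

  d<m : d < m
  d<m = ≤-<-trans (m≤n+m d I) I+d<m

  CommonNbr : Fin m → Set
  CommonNbr l = Adj m Δ i l × Adj m Δ j l

  common? : Decidable CommonNbr
  common? l = Adj? m Δ i l ×-dec Adj? m Δ j l

  common⇒realises : ∀ {l} (p : Adj m Δ i l) (q : Adj m Δ j l) →
    Realises d (toℕ (proj₁ p)) (toℕ (proj₁ q))
  common⇒realises {l} (k , e) (k′ , e′) =
    residues⇒realises I d I+d<m (toℕ<n k) (toℕ<n k′)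
      (trans e (sym (subst (λ J → (J + 2 ^ toℕ k′) % m ≡ idx l % m) j≡I+d e′)))

  -- The reading is unique, and fixes the residue of the common neighbour.
  common-unique : ∀ {l l′} → CommonNbr l → CommonNbr l′ → l ≡ l′
  common-unique {l} {l′} (p@(k , e) , q) (p′@(k′ , e′) , q′) =
    idx-residue-injective l l′ (trans (sym e) (trans (cong (λ a → (I + 2 ^ a) % m) same-exponent) e′))
    where
    same-exponent : toℕ k ≡ toℕ k′
    same-exponent = proj₁ (realises-unique d>0 d<m
      (toℕ<n k) (toℕ<n (proj₁ q)) (toℕ<n k′) (toℕ<n (proj₁ q′))
      (common⇒realises p q) (common⇒realises p′ q′))

  realises⇒common : ∀ {a b} → a < Δ → b < Δ → Realises d a b → Σ (Fin m) CommonNbr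
  realises⇒common {a} {b} a<Δ b<Δ r
    with residue-index (I + 2 ^ a) (≤-trans (m^n>0 2 a) (m≤n+m (2 ^ a) I))
  ... | l , el = l , adjacent a<Δ el , adjacent b<Δ (begin
    (toℕ j + 2 ^ b) % m  ≡⟨ cong (λ J → (J + 2 ^ b) % m) j≡I+d ⟩
    (I + d + 2 ^ b) % m  ≡⟨ sym (realises⇒residues I d {a} {b} (<⇒≤ d<m) r) ⟩
    (I + 2 ^ a) % m      ≡⟨ el ⟩
    idx l % m            ∎)
    where open ≡-Reasoning

  index-distance : indexDist m i j ≡ d ⊓ (m ∸ d)
  index-distance = cong (λ x → x ⊓ (m ∸ x)) (cong (_+ d) (m≤n⇒m∸n≡0 (<⇒≤ i<j)))

  at-most-one : numCommon m Δ i j ≤ 1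
  at-most-one = filter-length≤1 common? (allFin m) (allFin⁺ m) common-unique

  exactly-one⇔InM : (numCommon m Δ i j ≡ 1) ⇔ InM Δ (indexDist m i j)
  exactly-one⇔InM = mk⇔ one⇒InM InM⇒one
    where
    one⇒InM : numCommon m Δ i j ≡ 1 → InM Δ (indexDist m i j)
    one⇒InM one with filter-witness common? (allFin m) (subst (0 <_) (sym one) z<s)
    ... | _ , p@(k , _) , q@(k′ , _) = subst (InM Δ) (sym index-distance)
      (realises⇒InM d>0 d<m (toℕ<n k) (toℕ<n k′) (common⇒realises p q))

    InM⇒one : InM Δ (indexDist m i j) → numCommon m Δ i j ≡ 1
    InM⇒one x∈M with InM⇒realises (subst (InM Δ) index-distance x∈M)
    ... | _ , _ , a<Δ , b<Δ , r with realises⇒common a<Δ b<Δ r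
    ... | l , common = ≤-antisym at-most-one (filter-some common? (lose (∈-allFin l) common))

-- Lemma 2.7: for i < j, u_i and u_j have at most one common neighbour, and
-- exactly one iff id(u_i, u_j) ∈ 𝓜_Δ.
lemma2p7 : (n m Δ : ℕ) .{{_ : NonZero m}} → n ≡ 2 * m → 2 ≤ n →
    1 ≤ Δ → Δ ≤ ⌊log₂ n ⌋ → 2 ^ Δ Data.Nat.< m + 2 →
    ((i j : Fin m) → i Data.Fin.< j → numCommon m Δ i j ≤ 1) ×
    ((i j : Fin m) → i Data.Fin.< j → (numCommon m Δ i j ≡ 1) ⇔ InM Δ (indexDist m i j))
lemma2p7 n m Δ _ _ _ _ 2^Δ<m+2 = at-most-one , exactly-one⇔InM
  where
  short : 2 ^ Δ ≤ m + 1
  short = s≤s⁻¹ (subst (2 ^ Δ <_) (+-suc m 1) 2^Δ<m+2)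
  open Pair m Δ short
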